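{- Let $k,\ell\ge1$, $\lambda\in\mathrm{Par}^k_\ell$, $\Phi=\Delta^k(\lambda)$ and $m\in[\ell]$. Then $$H(\Phi;\lambda-\epsilon_m)=\sum_{z\in\mathrm{downpath}_\Phi(m)}t^{B_\Phi(m,z)}\,\mathfrak s^{(k)}_{\lambda-\epsilon_z}.$$
   Context: For $\gamma\in\mathbb Z^\ell$, $s_\gamma=\det(h_{\gamma_i+j-i})_{1\le i,j\le\ell}$; $\epsilon_i$ standard basis vectors of $\mathbb Z^\ell$. $\Delta^+_\ell=\{(i,j):1\le i<j\le\ell\}$ with order $(a,b)\le(c,d)$ iff $a\ge c$ and $b\le d$; a root ideal is an upper order ideal; $\alpha\in\Psi$ is removable if $\Psi\setminus\{\alpha\}$ is a root ideal. For $\Psi\subset\Delta^+_\ell$, $H(\Psi;\gamma)$ is obtained by expanding $\prod_{(i,j)\in\Psi}(1-tz_i/z_j)^{ -1}z^\gamma$ as a power series in $t$ and applying coefficientwise the linear map $z^\beta\mapsto s_\beta$. $\mathrm{Par}^k_\ell=\{\nu\in\mathbb Z^\ell:k\ge\nu_1\ge\dots\ge\nu_\ell\ge0\}$. For $\nu\in\mathbb Z^\ell$ with entries $\le k$, $\Delta^k(\nu)=\{(i,j)\in\Delta^+_\ell:k-\nu_i+i<j\}$ and $\mathfrak s^{(k)}_\nu=H(\Delta^k(\nu);\nu)$. $\mathrm{down}_\Phi(x)=j$ if $(x,j)$ is a removable root of $\Phi$ (undefined otherwise); $\mathrm{downpath}_\Phi(m)=(m,\mathrm{down}_\Phi(m),\mathrm{down}^2_\Phi(m),\dots)$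 continued as long as defined; for $z=\mathrm{down}^j_\Phi(m)$, $B_\Phi(m,z)=j$. -}

module Defs where

open import Algebra.Bundles using (CommutativeRing)
open import Data.Bool using (if_then_else_)
open import Data.Nat as ℕ using (ℕ; zero; suc; _∸_)
open import Data.Integer as ℤ using (ℤ; +_; -[1+_])
open import Data.Fin as Fin using (Fin; toℕ; punchIn)
open import Data.List using (List; []; _∷_; filter; concatMap; map; allFin)
open import Data.Product using (_×_; _,_)
open import Relation.Binary.PropositionalEquality using (_≡_)
open import Relation.Nullary using (¬_; Dec; does)
open import Relation.Nullary.Decidable using (_×-dec_)

-- Indices: Fin ℓ, 0-based (index i here is index i+1 of the paper).
-- Vectors in ℤ^ℓ are functions Fin ℓ → ℤ.

ε : ∀ {ℓ} → Fin ℓ → Fin ℓ → ℤ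
ε i x = if does (i Fin.≟ x) then + 1 else + 0

_-ε_ : ∀ {ℓ} → (Fin ℓ → ℤ) → Fin ℓ → (Fin ℓ → ℤ)
(γ -ε m) x = γ x ℤ.- ε m x

addRoot : ∀ {ℓ} → ℕ → Fin ℓ × Fin ℓ → (Fin ℓ → ℤ) → (Fin ℓ → ℤ)
addRoot n (i , j) γ x = γ x ℤ.+ (+ n ℤ.* ε i x) ℤ.- (+ n ℤ.* ε j x)

toZ : ∀ {ℓ} → (Fin ℓ → ℕ) → (Fin ℓ → ℤ)
toZ ν x = + ν x

IsPar : ∀ {ℓ} → ℕ → (Fin ℓ → ℕ) → Set
IsPar {ℓ} k ν = (∀ i → ν i ℕ.≤ k) × (∀ (i j : Fin ℓ) → toℕ i ℕ.≤ toℕ j → ν j ℕ.≤ ν i)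

-- Sets of positive roots: a predicate on pairs (i , j); elements of
-- Δ⁺_ℓ are pairs with i < j.

RootSet : ℕ → Set₁
RootSet ℓ = Fin ℓ → Fin ℓ → Set

_≤R_ : ∀ {ℓ} → Fin ℓ × Fin ℓ → Fin ℓ × Fin ℓ → Set
(a , b) ≤R (c , d) = (toℕ c ℕ.≤ toℕ a) × (toℕ b ℕ.≤ toℕ d)

IsRootIdeal : ∀ {ℓ} → RootSet ℓ → Set
IsRootIdeal {ℓ} Ψ =
  (∀ a b → Ψ a b → toℕ a ℕ.< toℕ b) ×
  (∀ a b c d → Ψ a b → toℕ c ℕ.< toℕ d → (a , b) ≤R (c , d) → Ψ c d)

_∖[_,_] : ∀ {ℓ} → RootSet ℓ → Fin ℓ → Fin ℓ → RootSet ℓ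
(Ψ ∖[ i , j ]) a b = Ψ a b × ¬ ((a ≡ i) × (b ≡ j))

Removable : ∀ {ℓ} → RootSet ℓ → Fin ℓ → Fin ℓ → Set
Removable Ψ i j = Ψ i j × IsRootIdeal (Ψ ∖[ i , j ])

-- DownPath Φ m zs : zs = downpath_Φ(m) = (m, down(m), down²(m), ...),
-- continued as long as down is defined (down_Φ(x) = j iff (x,j) removable).
-- The position of z in zs is B_Φ(m,z).
data DownPath {ℓ} (Φ : RootSet ℓ) : Fin ℓ → List (Fin ℓ) → Set where
  stop : ∀ {x} → (∀ j → ¬ Removable Φ x j) → DownPath Φ x (x ∷ [])
  step : ∀ {x j zs} → Removable Φ x j → DownPath Φ j zs → DownPath Φ x (x ∷ zs)

Δk : ∀ {ℓ} → ℕ → (Fin ℓ → ℤ) → RootSet ℓ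
Δk k ν i j = (toℕ i ℕ.< toℕ j) × ((+ k ℤ.- ν i ℤ.+ + toℕ i) ℤ.< + toℕ j)

Δk? : ∀ {ℓ} k (ν : Fin ℓ → ℤ) → ∀ i j → Dec (Δk k ν i j)
Δk? k ν i j = (toℕ i ℕ.<? toℕ j) ×-dec ((+ k ℤ.- ν i ℤ.+ + toℕ i) ℤ.<? + toℕ j)

rootsOf : ∀ {ℓ} (Ψ : RootSet ℓ) → (∀ i j → Dec (Ψ i j)) → List (Fin ℓ × Fin ℓ)
rootsOf {ℓ} Ψ Ψ? =
  filter (λ { (i , j) → (toℕ i ℕ.<? toℕ j) ×-dec Ψ? i j })
         (concatMap (λ i → map (λ j → (i , j)) (allFin ℓ)) (allFin ℓ))

-- Symmetric functions.  Λ = ℤ[h₁,h₂,…] is free on the h_r, so an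
-- identity in Λ is the same as an identity in every commutative ring R
-- for every choice of values hs r = h_{r+1} ∈ R (h₀ = 1, h_{<0} = 0).

module WithRing {c r} (R : CommutativeRing c r) (hs : ℕ → CommutativeRing.Carrier R) where
  open CommutativeRing R using (Carrier; _+_; _*_; -_; 0#; 1#)

  hZ : ℤ → Carrier
  hZ (+ zero)  = 1#
  hZ (+ suc n) = hs n
  hZ -[1+ n ]  = 0#

  sumFin : ∀ n → (Fin n → Carrier) → Carrier
  sumFin zero    f = 0#
  sumFin (suc n) f = f Fin.zero + sumFin n (λ x → f (Fin.suc x))

  sign : ℕ → Carrier
  sign zero    = 1#
  sign (suc n) = - sign n

  det : ∀ n → (Fin n → Fin n → Carrier) → Carrier
  det zero    M = 1#
  det (suc n) M =
    sumFin (suc n) (λ j → sign (toℕ j) *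
      (M Fin.zero j * det n (λ a b → M (Fin.suc a) (punchIn j b))))

  s : ∀ {ℓ} → (Fin ℓ → ℤ) → Carrier
  s {ℓ} γ = det ℓ (λ i j → hZ (γ i ℤ.+ + toℕ j ℤ.- + toℕ i))

  -- formal power series in t with coefficients in R: d ↦ coefficient of t^d
  Series : Set c
  Series = ℕ → Carrier

  sumUpTo : ℕ → (ℕ → Carrier) → Carrier
  sumUpTo zero    f = f zero
  sumUpTo (suc d) f = sumUpTo d f + f (suc d)

  -- ∏_{α ∈ αs} (1 - t z^α)^{-1} z^γ, expanded in t, then z^β ↦ s_β
  expand : ∀ {ℓ} → List (Fin ℓ × Fin ℓ) → (Fin ℓ → ℤ) → Series
  expand []       γ zero    = s γ
  expand []       γ (suc d) = 0#
  expand (α ∷ αs) γ d = sumUpTo d (λ n → expand αs (addRoot n α γ) (d ∸ n))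

  H : ∀ {ℓ} (Ψ : RootSet ℓ) → (∀ i j → Dec (Ψ i j)) → (Fin ℓ → ℤ) → Series
  H Ψ Ψ? γ = expand (rootsOf Ψ Ψ?) γ

  kSchur : ∀ {ℓ} → ℕ → (Fin ℓ → ℤ) → Series
  kSchur k ν = H (Δk k ν) (Δk? k ν) ν

  tPow : ℕ → Series → Series
  tPow b F d = if does (b ℕ.≤? d) then F (d ∸ b) else 0#

  pathSum : ∀ {ℓ} → ℕ → List (Fin ℓ) → (Fin ℓ → Series) → Series
  pathSum b []       F d = 0#
  pathSum b (z ∷ zs) F d = tPow b (F z) d + pathSum (suc b) zs F d

module Submission where

-- Expanding the factor of a root α = (i , j) as (1 − t z^α)⁻¹ = 1 + t z^α (1 − t z^α)⁻¹ gives
--   H(Ψ; γ) = H(Ψ ∖ α; γ) + t H(Ψ; γ + ε_i − ε_j).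
-- Lowering λ_m by one removes from Δ^k exactly the root (m , j) with j = k − λ_m + m + 1, where
-- row m of Φ = Δ^k(λ) begins.  Because λ is a partition, (m , j) ∈ Φ iff it is removable, i.e.
-- iff j = down_Φ(m); so H(Φ; λ − ε_m) is 𝔰^(k)_{λ−ε_m} + t H(Φ; λ − ε_j) if down_Φ(m) = j, and
-- 𝔰^(k)_{λ−ε_m} at the end of the downpath.

open import Algebra.Bundles using (CommutativeRing)
import Algebra.Properties.CommutativeSemigroup as CommutativeSemigroupProperties
open import Data.Bool using (true; false; if_then_else_)
open import Data.Empty using (⊥)
open import Data.Fin as Fin using (Fin; toℕ; punchIn)
import Data.Fin.Properties as Finₚ
open import Data.Integer as ℤ using (ℤ; +_)
import Data.Integer.Properties as ℤₚ
open import Data.Integer.Solver using (module +-*-Solver)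
open import Data.List using (List; []; _∷_; _++_; filter; concatMap; map; allFin; cartesianProduct)
open import Data.List.Membership.Propositional using (_∈_)
import Data.List.Membership.Propositional.Properties as ∈ₚ
open import Data.List.Properties using (filter-accept; filter-reject; filter-≐)
open import Data.List.Relation.Unary.All as All using (All; []; _∷_)
open import Data.List.Relation.Unary.AllPairs using (_∷_)
open import Data.List.Relation.Unary.Any using (here; there)
open import Data.List.Relation.Unary.Unique.Propositional using (Unique)
import Data.List.Relation.Unary.Unique.Propositional.Properties as Uniqueₚ
open import Data.Nat as ℕ using (ℕ; zero; suc; _≤_; _<_; _∸_; z≤n)
import Data.Nat.Properties as ℕₚ
open import Data.Product using (_×_; _,_; proj₁; proj₂; ∃₂)
open import Function using (_∘_)
open import Function.Bundles using (_⇔_; mk⇔; Equivalence)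
open import Relation.Binary.PropositionalEquality using (_≡_; _≢_; refl; sym; trans; cong; cong₂; subst; subst₂)
open import Relation.Nullary using (Dec; yes; no; ¬_)
open import Relation.Nullary.Decidable using (dec-true; dec-false; _×-dec_)
open import Relation.Unary using (Pred; Decidable)

open import Defs

open Equivalence using (to; from)

addRoot-zero : ∀ {ℓ} (α : Fin ℓ × Fin ℓ) γ x → addRoot 0 α γ x ≡ γ x
addRoot-zero (i , j) γ x =
  solve 3 (λ g a b → g :+ con (+ 0) :* a :- con (+ 0) :* b := g) refl (γ x) (ε i x) (ε j x)
  where open +-*-Solver

addRoot-suc : ∀ {ℓ} n (α : Fin ℓ × Fin ℓ) γ x → addRoot (suc n) α γ x ≡ addRoot n α (addRoot 1 α γ) x
addRoot-suc n (i , j) γ x =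
  solve 4 (λ g a b m → g :+ (con (+ 1) :+ m) :* a :- (con (+ 1) :+ m) :* b
                     := (g :+ con (+ 1) :* a :- con (+ 1) :* b) :+ m :* a :- m :* b)
    refl (γ x) (ε i x) (ε j x) (+ n)
  where open +-*-Solver

addRoot-comm : ∀ {ℓ} n (α β : Fin ℓ × Fin ℓ) γ x → addRoot n β (addRoot 1 α γ) x ≡ addRoot 1 α (addRoot n β γ) x
addRoot-comm n (i , j) (i′ , j′) γ x =
  solve 6 (λ g a b a′ b′ m → (g :+ con (+ 1) :* a :- con (+ 1) :* b) :+ m :* a′ :- m :* b′
                           := (g :+ m :* a′ :- m :* b′) :+ con (+ 1) :* a :- con (+ 1) :* b)
    refl (γ x) (ε i x) (ε j x) (ε i′ x) (ε j′ x) (+ n)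
  where open +-*-Solver

addRoot-ε : ∀ {ℓ} (γ : Fin ℓ → ℤ) i j x → addRoot 1 (i , j) (γ -ε i) x ≡ (γ -ε j) x
addRoot-ε γ i j x =
  solve 3 (λ g a b → g :- a :+ con (+ 1) :* a :- con (+ 1) :* b := g :- b) refl (γ x) (ε i x) (ε j x)
  where open +-*-Solver

ε-self : ∀ {ℓ} (x : Fin ℓ) → ε x x ≡ + 1
ε-self x = cong (if_then + 1 else + 0) (dec-true (x Fin.≟ x) refl)

ε-other : ∀ {ℓ} {x a : Fin ℓ} → x ≢ a → ε x a ≡ + 0
ε-other {x = x} {a} x≢a = cong (if_then + 1 else + 0) (dec-false (x Fin.≟ a) x≢a)

module _ {a p q} {A : Set a} {P : Pred A p} {Q : Pred A q} (P? : Decidable P) (Q? : Decidable Q) where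

  filter-≐-on : ∀ {xs} → All (λ x → P x ⇔ Q x) xs → filter P? xs ≡ filter Q? xs
  filter-≐-on {[]}     []                = refl
  filter-≐-on {x ∷ xs} (Px⇔Qx ∷ P⇔Q) with Q? x
  ... | yes Qx = trans (filter-accept P? (from Px⇔Qx Qx)) (cong (x ∷_) (filter-≐-on P⇔Q))
  ... | no ¬Qx = trans (filter-reject P? (¬Qx ∘ to Px⇔Qx)) (filter-≐-on P⇔Q)

  filter-split : ∀ {α xs} → Unique xs → α ∈ xs → P α → ¬ Q α → (∀ x → x ≢ α → P x ⇔ Q x) →
                 ∃₂ λ us vs → filter P? xs ≡ us ++ α ∷ vs × filter Q? xs ≡ us ++ vs
  filter-split {α} {α ∷ xs} (α∉xs ∷ _) (here refl) Pα ¬Qα P⇔Q =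
    [] , filter Q? xs ,
    trans (filter-accept P? Pα) (cong (α ∷_) (filter-≐-on (All.map (λ α≢x → P⇔Q _ (α≢x ∘ sym)) α∉xs))) ,
    filter-reject Q? ¬Qα
  filter-split {α} {y ∷ xs} (y∉xs ∷ unique) (there α∈xs) Pα ¬Qα P⇔Q
    with us , vs , P-split , Q-split ← filter-split unique α∈xs Pα ¬Qα P⇔Q
       | Q? y
  ... | yes Qy = y ∷ us , vs ,
                 trans (filter-accept P? (from (P⇔Q y y≢α) Qy)) (cong (y ∷_) P-split) ,
                 cong (y ∷_) Q-split
    where y≢α = All.lookup y∉xs α∈xs
  ... | no ¬Qy = us , vs ,
                 trans (filter-reject P? (¬Qy ∘ to (P⇔Q y y≢α))) P-split ,
                 Q-split
    where y≢α = All.lookup y∉xs α∈xs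

pairs : ∀ ℓ → List (Fin ℓ × Fin ℓ)
pairs ℓ = concatMap (λ i → map (λ j → (i , j)) (allFin ℓ)) (allFin ℓ)

concatMap-pairing : ∀ {a b} {A : Set a} {B : Set b} (xs : List A) (ys : List B) →
                    concatMap (λ x → map (λ y → (x , y)) ys) xs ≡ cartesianProduct xs ys
concatMap-pairing []       ys = refl
concatMap-pairing (x ∷ xs) ys = cong (map (λ y → (x , y)) ys ++_) (concatMap-pairing xs ys)

pairs-unique : ∀ ℓ → Unique (pairs ℓ)
pairs-unique ℓ = subst Unique (sym (concatMap-pairing (allFin ℓ) (allFin ℓ)))
                       (Uniqueₚ.cartesianProduct⁺ (Uniqueₚ.allFin⁺ ℓ) (Uniqueₚ.allFin⁺ ℓ))

∈-pairs : ∀ {ℓ} (α : Fin ℓ × Fin ℓ) → α ∈ pairs ℓ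
∈-pairs {ℓ} (i , j) = subst ((i , j) ∈_) (sym (concatMap-pairing (allFin ℓ) (allFin ℓ)))
                            (∈ₚ.∈-cartesianProduct⁺ (∈ₚ.∈-allFin i) (∈ₚ.∈-allFin j))

module _ {ℓ} {Ψ Ψ′ : RootSet ℓ} (Ψ? : ∀ i j → Dec (Ψ i j)) (Ψ′? : ∀ i j → Dec (Ψ′ i j)) where

  private
    Positive : RootSet ℓ → Pred (Fin ℓ × Fin ℓ) _
    Positive Θ (i , j) = toℕ i < toℕ j × Θ i j

    positive? : ∀ {Θ : RootSet ℓ} → (∀ i j → Dec (Θ i j)) → Decidable (Positive Θ)
    positive? Θ? (i , j) = (toℕ i ℕ.<? toℕ j) ×-dec Θ? i j

    positive-⇔ : ∀ {i j} → (Ψ i j ⇔ Ψ′ i j) → Positive Ψ (i , j) ⇔ Positive Ψ′ (i , j)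
    positive-⇔ Ψ⇔Ψ′ = mk⇔ (λ (i<j , ψ) → i<j , to Ψ⇔Ψ′ ψ) (λ (i<j , ψ′) → i<j , from Ψ⇔Ψ′ ψ′)

  rootsOf-cong : (∀ i j → Ψ i j ⇔ Ψ′ i j) → rootsOf Ψ Ψ? ≡ rootsOf Ψ′ Ψ′?
  rootsOf-cong Ψ⇔Ψ′ = filter-≐ (positive? Ψ?) (positive? Ψ′?)
    ((λ {(i , j)} → to (positive-⇔ (Ψ⇔Ψ′ i j))) , (λ {(i , j)} → from (positive-⇔ (Ψ⇔Ψ′ i j)))) (pairs ℓ)

  rootsOf-split : ∀ {a b} → toℕ a < toℕ b → Ψ a b → (∀ i j → Ψ′ i j ⇔ (Ψ ∖[ a , b ]) i j) →
                  ∃₂ λ us vs → rootsOf Ψ Ψ? ≡ us ++ (a , b) ∷ vs × rootsOf Ψ′ Ψ′? ≡ us ++ vs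
  rootsOf-split {a} {b} a<b ψ Ψ′⇔Ψ∖ab =
    filter-split (positive? Ψ?) (positive? Ψ′?) (pairs-unique ℓ) (∈-pairs (a , b)) (a<b , ψ)
      (λ (_ , ψ′) → proj₂ (to (Ψ′⇔Ψ∖ab a b) ψ′) (refl , refl))
      (λ (i , j) ij≢ab → positive-⇔ (mk⇔ (λ ψ → from (Ψ′⇔Ψ∖ab i j) (ψ , λ { (refl , refl) → ij≢ab refl }))
                                        (proj₁ ∘ to (Ψ′⇔Ψ∖ab i j))))

removable-minimal : ∀ {ℓ} {Ψ : RootSet ℓ} {a b c d} → Removable Ψ a b → toℕ a < toℕ b →
                    (Ψ ∖[ a , b ]) c d → (c , d) ≤R (a , b) → ⊥
removable-minimal {c = c} {d} (_ , _ , upward) a<b ψcd cd≤ab =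
  proj₂ (upward c d _ _ ψcd a<b cd≤ab) (refl , refl)

minimal-removable : ∀ {ℓ} {Ψ : RootSet ℓ} {a b} → IsRootIdeal Ψ → Ψ a b →
                    (∀ c d → Ψ c d → (c , d) ≤R (a , b) → c ≡ a × d ≡ b) → Removable Ψ a b
minimal-removable (positive , upward) ψab minimal =
  ψab , (λ c d → positive c d ∘ proj₁) ,
  λ c d c′ d′ (ψcd , cd≢ab) c′<d′ cd≤c′d′ →
    upward c d c′ d′ ψcd c′<d′ cd≤c′d′ , λ { (refl , refl) → cd≢ab (minimal c d ψcd cd≤c′d′) }

+-cancelʳ-<ℤ : ∀ z {x y : ℤ} → x ℤ.+ z ℤ.< y ℤ.+ z → x ℤ.< y
+-cancelʳ-<ℤ z {x} {y} x+z<y+z = subst₂ ℤ._<_ (cancel x) (cancel y) (ℤₚ.+-monoˡ-< (ℤ.- z) x+z<y+z)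
  where
  open +-*-Solver
  cancel : ∀ w → w ℤ.+ z ℤ.- z ≡ w
  cancel w = solve 2 (λ w z → w :+ z :- z := w) refl w z

Δk-ℕ : ∀ {ℓ} k (γ : Fin ℓ → ℤ) (a b : Fin ℓ) {n e} → γ a ≡ + n ℤ.- + e →
       Δk k γ a b ⇔ (toℕ a < toℕ b × e ℕ.+ (k ℕ.+ toℕ a) < toℕ b ℕ.+ n)
Δk-ℕ k γ a b {n} {e} γa≡n-e = mk⇔
  (λ (a<b , h) → a<b , ℤₚ.drop‿+<+ (subst (ℤ._< _) shift (ℤₚ.+-monoˡ-< (+ n) (subst Row γa≡n-e h))))
  (λ (a<b , h) → a<b , subst Row (sym γa≡n-e) (+-cancelʳ-<ℤ (+ n) (subst (ℤ._< _) (sym shift) (ℤ.+<+ h))))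
  where
  Row : ℤ → Set
  Row g = + k ℤ.- g ℤ.+ + toℕ a ℤ.< + toℕ b
  open +-*-Solver
  shift : + k ℤ.- (+ n ℤ.- + e) ℤ.+ + toℕ a ℤ.+ + n ≡ + e ℤ.+ (+ k ℤ.+ + toℕ a)
  shift = solve 4 (λ k n e a → k :- (n :- e) :+ a :+ n := e :+ (k :+ a)) refl (+ k) (+ n) (+ e) (+ toℕ a)

pred-toℕ : ∀ {ℓ} (j : Fin ℓ) → 0 < toℕ j → suc (toℕ (Fin.pred j)) ≡ toℕ j
pred-toℕ (Fin.suc i) _ = cong suc (Finₚ.toℕ-inject₁ i)

Decreasing : ∀ {ℓ} → (Fin ℓ → ℕ) → Set
Decreasing ν = ∀ i j → toℕ i ≤ toℕ j → ν j ≤ ν i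

module _ {ℓ} (k : ℕ) (ν : Fin ℓ → ℕ) where

  Δk-toZ : ∀ a b → Δk k (toZ ν) a b ⇔ (toℕ a < toℕ b × k ℕ.+ toℕ a < toℕ b ℕ.+ ν a)
  Δk-toZ a b = Δk-ℕ k (toZ ν) a b {e = 0} (sym (ℤₚ.+-identityʳ (+ ν a)))

  Δk-toZ-ε-self : ∀ x b → Δk k (toZ ν -ε x) x b ⇔ (toℕ x < toℕ b × suc (k ℕ.+ toℕ x) < toℕ b ℕ.+ ν x)
  Δk-toZ-ε-self x b = Δk-ℕ k (toZ ν -ε x) x b (cong (λ e → + ν x ℤ.- e) (ε-self x))

  Δk-toZ-ε-other : ∀ {x a} b → x ≢ a → Δk k (toZ ν -ε x) a b ⇔ Δk k (toZ ν) a b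
  Δk-toZ-ε-other {x} {a} b x≢a = mk⇔ (from (Δk-toZ a b) ∘ to lowered) (from lowered ∘ to (Δk-toZ a b))
    where lowered = Δk-ℕ k (toZ ν -ε x) a b {e = 0} (cong (λ e → + ν a ℤ.- e) (ε-other x≢a))

  -- b = k − ν_a + a + 1 is the column in which row a of Δ^k(ν) begins
  RowStart : Fin ℓ → Fin ℓ → Set
  RowStart a b = toℕ b ℕ.+ ν a ≡ suc (k ℕ.+ toℕ a)

  Δk-minus-ε : ∀ x a b → Δk k (toZ ν -ε x) a b ⇔ (Δk k (toZ ν) a b × ¬ (a ≡ x × RowStart x b))
  Δk-minus-ε x a b with a Fin.≟ x
  ... | yes refl = mk⇔
    (λ h → let x<b , row = to (Δk-toZ-ε-self x b) h
           in from (Δk-toZ x b) (x<b , ℕₚ.<⇒≤ row) , λ (_ , start) → ℕₚ.<⇒≢ row (sym start))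
    (λ (φ , ¬start) → let x<b , row = to (Δk-toZ x b) φ
                      in from (Δk-toZ-ε-self x b) (x<b , ℕₚ.≤∧≢⇒< row (λ eq → ¬start (refl , sym eq))))
  ... | no a≢x = mk⇔ (λ h → to (Δk-toZ-ε-other b (a≢x ∘ sym)) h , a≢x ∘ proj₁)
                     (from (Δk-toZ-ε-other b (a≢x ∘ sym)) ∘ proj₁)

  Δk-isRootIdeal : Decreasing ν → IsRootIdeal (Δk k (toZ ν))
  Δk-isRootIdeal decreasing = (λ _ _ → proj₁) , λ a b c d φab c<d (c≤a , b≤d) →
    from (Δk-toZ c d) (c<d , ℕₚ.≤-<-trans (ℕₚ.+-monoʳ-≤ k c≤a)
                              (ℕₚ.<-≤-trans (proj₂ (to (Δk-toZ a b) φab))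
                                            (ℕₚ.+-mono-≤ b≤d (decreasing c a c≤a))))

  rowStart⇒removable : ∀ {x b} → Decreasing ν → Δk k (toZ ν) x b → RowStart x b →
                       Removable (Δk k (toZ ν)) x b
  rowStart⇒removable {x} {b} decreasing φxb start = minimal-removable (Δk-isRootIdeal decreasing) φxb minimal
    where
    minimal : ∀ c d → Δk k (toZ ν) c d → (c , d) ≤R (x , b) → c ≡ x × d ≡ b
    minimal c d φcd (x≤c , d≤b) = c≡x , d≡b
      where
      row : ∀ {c} → Δk k (toZ ν) c d → k ℕ.+ toℕ c < toℕ d ℕ.+ ν c
      row φ = proj₂ (to (Δk-toZ _ d) φ)
      c≡x : c ≡ x
      c≡x = Finₚ.toℕ-injective (ℕₚ.≤-antisym
        (ℕₚ.+-cancelˡ-≤ k _ _ (ℕ.s≤s⁻¹ (ℕₚ.<-≤-trans (row φcd)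
          (ℕₚ.≤-trans (ℕₚ.+-mono-≤ d≤b (decreasing x c x≤c)) (ℕₚ.≤-reflexive start)))))
        x≤c)
      d≡b : d ≡ b
      d≡b = Finₚ.toℕ-injective (ℕₚ.≤-antisym d≤b
        (ℕₚ.+-cancelʳ-≤ (ν x) _ _ (ℕₚ.≤-trans (ℕₚ.≤-reflexive start) (row (subst (λ c → Δk k (toZ ν) c d) c≡x φcd)))))

  removable⇒rowStart : ∀ {x j} → ν x ≤ k → Removable (Δk k (toZ ν)) x j → RowStart x j
  removable⇒rowStart {x} {j} νx≤k removable@(φxj , _) =
    ℕₚ.≤-antisym (ℕₚ.≮⇒≥ beyond) row
    where
    x<j = proj₁ (to (Δk-toZ x j) φxj)
    row = proj₂ (to (Δk-toZ x j) φxj)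
    -- otherwise (x , j − 1) would be a root of Δ^k(ν) below (x , j)
    beyond : ¬ (suc (k ℕ.+ toℕ x) < toℕ j ℕ.+ ν x)
    beyond h = removable-minimal removable x<j (φxb , λ (_ , b≡j) → ℕₚ.<-irrefl (cong toℕ b≡j) b<j)
                                               (ℕₚ.≤-refl , ℕₚ.<⇒≤ b<j)
      where
      b = Fin.pred j
      j≡1+b = sym (pred-toℕ j (ℕₚ.≤-<-trans z≤n x<j))
      b<j : toℕ b < toℕ j
      b<j = ℕₚ.≤-reflexive (sym j≡1+b)
      rowb : k ℕ.+ toℕ x < toℕ b ℕ.+ ν x
      rowb = ℕ.s<s⁻¹ (subst (λ n → suc (k ℕ.+ toℕ x) < n ℕ.+ ν x) j≡1+b h)
      x<b : toℕ x < toℕ b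
      x<b = ℕₚ.+-cancelʳ-< (ν x) _ _
              (ℕₚ.≤-<-trans (ℕₚ.≤-trans (ℕₚ.+-monoʳ-≤ (toℕ x) νx≤k) (ℕₚ.≤-reflexive (ℕₚ.+-comm (toℕ x) k))) rowb)
      φxb : Δk k (toZ ν) x b
      φxb = from (Δk-toZ x b) (x<b , rowb)

  Δk-minus-ε-removable : ∀ {x j} → ν x ≤ k → Removable (Δk k (toZ ν)) x j →
                         ∀ a b → Δk k (toZ ν -ε x) a b ⇔ (Δk k (toZ ν) ∖[ x , j ]) a b
  Δk-minus-ε-removable {x} {j} νx≤k removable a b = mk⇔
    (λ h → let φ , ¬start = to (Δk-minus-ε x a b) h
           in φ , λ (a≡x , b≡j) → ¬start (a≡x , subst (RowStart x) (sym b≡j) startj))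
    (λ (φ , ab≢xj) → from (Δk-minus-ε x a b)
      (φ , λ (a≡x , start) → ab≢xj (a≡x , Finₚ.toℕ-injective (ℕₚ.+-cancelʳ-≡ (ν x) _ _ (trans start (sym startj))))))
    where startj = removable⇒rowStart νx≤k removable

  Δk-minus-ε-noRemovable : ∀ {x} → Decreasing ν → (∀ j → ¬ Removable (Δk k (toZ ν)) x j) →
                           ∀ a b → Δk k (toZ ν -ε x) a b ⇔ Δk k (toZ ν) a b
  Δk-minus-ε-noRemovable {x} decreasing noRemovable a b = mk⇔
    (proj₁ ∘ to (Δk-minus-ε x a b))
    (λ φ → from (Δk-minus-ε x a b) (φ , λ { (refl , start) → noRemovable b (rowStart⇒removable decreasing φ start) }))

module WithRingProperties {c r} (R : CommutativeRing c r) (hs : ℕ → CommutativeRing.Carrier R) where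
  open CommutativeRing R
    using (Carrier; _≈_; _+_; _*_; setoid; reflexive; +-cong; +-congˡ; +-congʳ; +-assoc;
           +-identityˡ; +-identityʳ; +-commutativeSemigroup)
    renaming (refl to ≈-refl; sym to ≈-sym; trans to ≈-trans)
  open WithRing R hs
  open import Relation.Binary.Reasoning.Setoid setoid
  open CommutativeSemigroupProperties +-commutativeSemigroup using (interchange; xy∙z≈xz∙y)

  sumFin-cong : ∀ n {f g : Fin n → Carrier} → (∀ x → f x ≡ g x) → sumFin n f ≡ sumFin n g
  sumFin-cong zero    f≡g = refl
  sumFin-cong (suc n) f≡g = cong₂ _+_ (f≡g Fin.zero) (sumFin-cong n (f≡g ∘ Fin.suc))

  det-cong : ∀ n {M N : Fin n → Fin n → Carrier} → (∀ a b → M a b ≡ N a b) → det n M ≡ det n N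
  det-cong zero    M≡N = refl
  det-cong (suc n) M≡N = sumFin-cong (suc n) λ j →
    cong₂ (λ u v → sign (toℕ j) * (u * v)) (M≡N Fin.zero j) (det-cong n λ a b → M≡N (Fin.suc a) (punchIn j b))

  s-cong : ∀ {ℓ} {γ γ′ : Fin ℓ → ℤ} → (∀ x → γ x ≡ γ′ x) → s γ ≡ s γ′
  s-cong {ℓ} γ≡γ′ = det-cong ℓ λ i j → cong (λ g → hZ (g ℤ.+ + toℕ j ℤ.- + toℕ i)) (γ≡γ′ i)

  sumUpTo-cong : ∀ d {f g : ℕ → Carrier} → (∀ n → n ≤ d → f n ≈ g n) → sumUpTo d f ≈ sumUpTo d g
  sumUpTo-cong zero    f≈g = f≈g 0 z≤n
  sumUpTo-cong (suc d) f≈g = +-cong (sumUpTo-cong d λ n n≤d → f≈g n (ℕₚ.m≤n⇒m≤1+n n≤d)) (f≈g (suc d) ℕₚ.≤-refl)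

  sumUpTo-+ : ∀ d (f g : ℕ → Carrier) → sumUpTo d (λ n → f n + g n) ≈ sumUpTo d f + sumUpTo d g
  sumUpTo-+ zero    f g = ≈-refl
  sumUpTo-+ (suc d) f g = ≈-trans (+-congʳ (sumUpTo-+ d f g)) (interchange _ _ _ _)

  sumUpTo-suc : ∀ d (f : ℕ → Carrier) → sumUpTo (suc d) f ≈ f 0 + sumUpTo d (f ∘ suc)
  sumUpTo-suc zero    f = ≈-refl
  sumUpTo-suc (suc d) f = ≈-trans (+-congʳ (sumUpTo-suc d f)) (+-assoc _ _ _)

  expand-cong : ∀ {ℓ} (αs : List (Fin ℓ × Fin ℓ)) {γ γ′} → (∀ x → γ x ≡ γ′ x) → ∀ d → expand αs γ d ≈ expand αs γ′ d
  expand-cong []             γ≡γ′ zero    = reflexive (s-cong γ≡γ′)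
  expand-cong []             γ≡γ′ (suc d) = ≈-refl
  expand-cong ((i , j) ∷ αs) γ≡γ′ d       = sumUpTo-cong d λ n _ →
    expand-cong αs (λ x → cong (λ g → g ℤ.+ + n ℤ.* ε i x ℤ.- + n ℤ.* ε j x) (γ≡γ′ x)) (d ∸ n)

  expand-zero : ∀ {ℓ} (αs : List (Fin ℓ × Fin ℓ)) γ → expand αs γ 0 ≈ s γ
  expand-zero []       γ = ≈-refl
  expand-zero (α ∷ αs) γ = ≈-trans (expand-zero αs (addRoot 0 α γ)) (reflexive (s-cong (addRoot-zero α γ)))

  expand-insert : ∀ {ℓ} (xs ys : List (Fin ℓ × Fin ℓ)) α γ d →
                  expand (xs ++ α ∷ ys) γ (suc d) ≈ expand (xs ++ ys) γ (suc d) + expand (xs ++ α ∷ ys) (addRoot 1 α γ) d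
  expand-insert [] ys α γ d = begin
    sumUpTo (suc d) (λ n → expand ys (addRoot n α γ) (suc d ∸ n))
      ≈⟨ sumUpTo-suc d _ ⟩
    expand ys (addRoot 0 α γ) (suc d) + sumUpTo d (λ n → expand ys (addRoot (suc n) α γ) (d ∸ n))
      ≈⟨ +-cong (expand-cong ys (addRoot-zero α γ) (suc d))
                (sumUpTo-cong d λ n _ → expand-cong ys (addRoot-suc n α γ) (d ∸ n)) ⟩
    expand ys γ (suc d) + expand (α ∷ ys) (addRoot 1 α γ) d ∎
  expand-insert (β ∷ xs) ys α γ d = begin
    sumUpTo d (λ n → E (βⁿγ n) (suc d ∸ n)) + E (βⁿγ (suc d)) (d ∸ d)
      ≈⟨ +-cong (sumUpTo-cong d split) (lowest (βⁿγ (suc d))) ⟩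
    sumUpTo d (λ n → E′ (βⁿγ n) (suc d ∸ n) + E (addRoot 1 α (βⁿγ n)) (d ∸ n)) + E′ (βⁿγ (suc d)) (d ∸ d)
      ≈⟨ +-congʳ (sumUpTo-+ d _ _) ⟩
    (sumUpTo d (λ n → E′ (βⁿγ n) (suc d ∸ n)) + sumUpTo d (λ n → E (addRoot 1 α (βⁿγ n)) (d ∸ n)))
      + E′ (βⁿγ (suc d)) (d ∸ d)
      ≈⟨ xy∙z≈xz∙y _ _ _ ⟩
    expand (β ∷ xs ++ ys) γ (suc d) + sumUpTo d (λ n → E (addRoot 1 α (βⁿγ n)) (d ∸ n))
      ≈⟨ +-congˡ (sumUpTo-cong d λ n _ → expand-cong (xs ++ α ∷ ys) (λ x → sym (addRoot-comm n α β γ x)) (d ∸ n)) ⟩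
    expand (β ∷ xs ++ ys) γ (suc d) + expand (β ∷ xs ++ α ∷ ys) (addRoot 1 α γ) d ∎
    where
    E  = expand (xs ++ α ∷ ys)
    E′ = expand (xs ++ ys)
    βⁿγ : ℕ → Fin _ → ℤ
    βⁿγ n = addRoot n β γ
    split : ∀ n → n ≤ d → E (βⁿγ n) (suc d ∸ n) ≈ E′ (βⁿγ n) (suc d ∸ n) + E (addRoot 1 α (βⁿγ n)) (d ∸ n)
    split n n≤d rewrite ℕₚ.+-∸-assoc 1 n≤d = expand-insert xs ys α (βⁿγ n) (d ∸ n)
    lowest : ∀ δ → E δ (d ∸ d) ≈ E′ δ (d ∸ d)
    lowest δ rewrite ℕₚ.n∸n≡0 d = ≈-trans (expand-zero (xs ++ α ∷ ys) δ) (≈-sym (expand-zero (xs ++ ys) δ))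

  tPow-cong : ∀ b {F G : Series} → (∀ d → F d ≈ G d) → ∀ d → tPow b F d ≈ tPow b G d
  tPow-cong b F≈G d with b ℕ.≤ᵇ d
  ... | true  = F≈G (d ∸ b)
  ... | false = ≈-refl

  tPow-suc : ∀ b (F : Series) d → tPow (suc b) F (suc d) ≡ tPow b F d
  tPow-suc zero    F d = refl
  tPow-suc (suc b) F d = refl

  pathSum-suc : ∀ {ℓ} b zs (F : Fin ℓ → Series) d → pathSum (suc b) zs F d ≈ tPow 1 (pathSum b zs F) d
  pathSum-suc b []       F zero    = ≈-refl
  pathSum-suc b []       F (suc d) = ≈-refl
  pathSum-suc b (z ∷ zs) F zero    = ≈-trans (+-identityˡ _) (pathSum-suc (suc b) zs F zero)
  pathSum-suc b (z ∷ zs) F (suc d) = +-cong (reflexive (tPow-suc b (F z) d)) (pathSum-suc (suc b) zs F (suc d))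

  H-cong : ∀ {ℓ} {Ψ Ψ′ : RootSet ℓ} Ψ? Ψ′? → (∀ i j → Ψ i j ⇔ Ψ′ i j) → ∀ γ d → H Ψ Ψ? γ d ≡ H Ψ′ Ψ′? γ d
  H-cong Ψ? Ψ′? Ψ⇔Ψ′ γ d = cong (λ αs → expand αs γ d) (rootsOf-cong Ψ? Ψ′? Ψ⇔Ψ′)

  H-remove : ∀ {ℓ} {Ψ Ψ′ : RootSet ℓ} Ψ? Ψ′? {a b} → toℕ a < toℕ b → Ψ a b →
             (∀ i j → Ψ′ i j ⇔ (Ψ ∖[ a , b ]) i j) →
             ∀ γ d → H Ψ Ψ? γ d ≈ H Ψ′ Ψ′? γ d + tPow 1 (H Ψ Ψ? (addRoot 1 (a , b) γ)) d
  H-remove Ψ? Ψ′? a<b ψ Ψ′⇔Ψ∖ab γ zero =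
    ≈-trans (expand-zero (rootsOf _ Ψ?) γ) (≈-trans (≈-sym (expand-zero (rootsOf _ Ψ′?) γ)) (≈-sym (+-identityʳ _)))
  H-remove {Ψ = Ψ} {Ψ′} Ψ? Ψ′? {a} {b} a<b ψ Ψ′⇔Ψ∖ab γ (suc d)
    with us , vs , Ψ-split , Ψ′-split ← rootsOf-split Ψ? Ψ′? a<b ψ Ψ′⇔Ψ∖ab = begin
    H Ψ Ψ? γ (suc d)
      ≡⟨ cong (λ αs → expand αs γ (suc d)) Ψ-split ⟩
    expand (us ++ (a , b) ∷ vs) γ (suc d)
      ≈⟨ expand-insert us vs (a , b) γ d ⟩
    expand (us ++ vs) γ (suc d) + expand (us ++ (a , b) ∷ vs) (addRoot 1 (a , b) γ) d
      ≡⟨ sym (cong₂ (λ αs′ αs → expand αs′ γ (suc d) + expand αs (addRoot 1 (a , b) γ) d) Ψ′-split Ψ-split) ⟩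
    H Ψ′ Ψ′? γ (suc d) + tPow 1 (H Ψ Ψ? (addRoot 1 (a , b) γ)) (suc d) ∎

module DownPathExpansion {c r} (R : CommutativeRing c r) (hs : ℕ → CommutativeRing.Carrier R)
                         {ℓ} (k : ℕ) (lam : Fin ℓ → ℕ) where
  open CommutativeRing R using (_≈_; _+_; +-congˡ; +-identityʳ) renaming (sym to ≈-sym; trans to ≈-trans)
  open WithRing R hs
  open WithRingProperties R hs
  open import Relation.Binary.Reasoning.Setoid (CommutativeRing.setoid R)

  Φ : RootSet ℓ
  Φ = Δk k (toZ lam)

  Φ? : ∀ i j → Dec (Φ i j)
  Φ? = Δk? k (toZ lam)

  F : Fin ℓ → Series
  F z = kSchur k (toZ lam -ε z)

  downPath-expansion : IsPar k lam → ∀ {m zs} → DownPath Φ m zs →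
                       ∀ d → H Φ Φ? (toZ lam -ε m) d ≈ pathSum 0 zs F d
  downPath-expansion (_ , decreasing) {m} (stop noRemovable) d = begin
    H Φ Φ? (toZ lam -ε m) d
      ≡⟨ sym (H-cong _ _ (Δk-minus-ε-noRemovable k lam decreasing noRemovable) (toZ lam -ε m) d) ⟩
    F m d
      ≈⟨ ≈-sym (+-identityʳ _) ⟩
    pathSum 0 (m ∷ []) F d ∎
  downPath-expansion par@(lam≤k , _) {m} (step {j = j} {zs} removable@((m<j , _) , _) path) d = begin
    H Φ Φ? (toZ lam -ε m) d
      ≈⟨ H-remove _ _ m<j (proj₁ removable) (Δk-minus-ε-removable k lam (lam≤k m) removable) (toZ lam -ε m) d ⟩
    F m d + tPow 1 (H Φ Φ? (addRoot 1 (m , j) (toZ lam -ε m))) d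
      ≈⟨ +-congˡ (tPow-cong 1 (λ n → ≈-trans (expand-cong (rootsOf Φ Φ?) (addRoot-ε (toZ lam) m j) n)
                                              (downPath-expansion par path n)) d) ⟩
    F m d + tPow 1 (pathSum 0 zs F) d
      ≈⟨ +-congˡ (≈-sym (pathSum-suc 0 zs F d)) ⟩
    pathSum 0 (m ∷ zs) F d ∎

proposition9p1 : ∀ {c r} (R : CommutativeRing c r) (hs : ℕ → CommutativeRing.Carrier R)
                 (k ℓ : ℕ) → 1 ≤ k → 1 ≤ ℓ →
                 (lam : Fin ℓ → ℕ) → IsPar k lam →
                 (m : Fin ℓ) (zs : List (Fin ℓ)) →
                 DownPath (Δk k (toZ lam)) m zs →
                 ∀ d → CommutativeRing._≈_ R
                   (WithRing.H R hs (Δk k (toZ lam)) (Δk? k (toZ lam)) (toZ lam -ε m) d)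
                   (WithRing.pathSum R hs 0 zs (λ z → WithRing.kSchur R hs k (toZ lam -ε z)) d)
proposition9p1 R hs k ℓ _ _ lam par m zs path =
  DownPathExpansion.downPath-expansion R hs k lam par path
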